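{- For $|q|<1$, with $(a;q)_n=\prod_{k=0}^{n-1}(1-aq^k)$ and $(a)_n=(a;q)_n$, $$\sum_{n=0}^\infty\frac{(q)_n(-1)^nq^{n(n+1)/2}}{(-q)_n}=\sum_{n=0}^\infty\frac{(q;q^2)_n(-1)^nq^n}{(-q^2;q^2)_n}.$$ -}

module Defs where

open import Data.Nat using (ℕ; zero; suc; _∸_; _≤ᵇ_; _≡ᵇ_; _*_)
open import Data.Integer as ℤ using (ℤ; 0ℤ; 1ℤ; -1ℤ)
open import Data.Bool using (if_then_else_)

-- Formal power series in q with integer coefficients:
-- a series is its coefficient sequence  f k = [q^k] f.
FPS : Set
FPS = ℕ → ℤ

sumTo : ℕ → (ℕ → ℤ) → ℤ
sumTo zero    f = f 0
sumTo (suc n) f = ℤ._+_ (sumTo n f) (f (suc n))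

const : ℤ → FPS
const c zero    = c
const c (suc _) = 0ℤ

oneS : FPS
oneS = const 1ℤ

qS : FPS
qS 1 = 1ℤ
qS _ = 0ℤ

_⊕_ : FPS → FPS → FPS
(f ⊕ g) k = ℤ._+_ (f k) (g k)

negS : FPS → FPS
negS f k = ℤ.- (f k)

_⊖_ : FPS → FPS → FPS
f ⊖ g = f ⊕ negS g

_⊛_ : FPS → FPS → FPS
(f ⊛ g) n = sumTo n (λ i → ℤ._*_ (f i) (g (n ∸ i)))

infixl 7 _⊛_
infixl 6 _⊕_ _⊖_

powS : FPS → ℕ → FPS
powS f zero    = oneS
powS f (suc k) = f ⊛ powS f k

prodS : ℕ → (ℕ → FPS) → FPS
prodS zero    F = oneS
prodS (suc n) F = prodS n F ⊛ F n

-- Multiplicative inverse of a series with constant term 1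
-- (recursively: g 0 = 1, g n = - Σ_{i=1}^{n} f i * g (n - i)).
-- invAux n agrees with the inverse at all indices ≤ n.
invAux : FPS → ℕ → FPS
invAux f zero    k = if k ≡ᵇ 0 then 1ℤ else 0ℤ
invAux f (suc n) k =
  if k ≤ᵇ n then invAux f n k
  else (if k ≡ᵇ suc n
        then ℤ.- (sumTo n (λ j → ℤ._*_ (f (suc j)) (invAux f n (n ∸ j))))
        else 0ℤ)

invS : FPS → FPS
invS f k = invAux f k k

poch : FPS → FPS → ℕ → FPS
poch a b n = prodS n (λ k → oneS ⊖ a ⊛ powS b k)

-- Sum Σ_{n≥0} T n of a family of series with ord(T n) ≥ n (formally
-- convergent): its q^N coefficient is Σ_{n=0}^{N} [q^N] T n.
sumSeries : (ℕ → FPS) → FPS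
sumSeries T N = sumTo N (λ n → T n N)

signS : ℕ → FPS
signS n = powS (const -1ℤ) n

tri : ℕ → ℕ
tri zero    = zero
tri (suc n) = suc n Data.Nat.+ tri n

lhsTerm : ℕ → FPS
lhsTerm n = poch qS qS n ⊛ signS n ⊛ powS qS (tri n) ⊛ invS (poch (negS qS) qS n)

rhsTerm : ℕ → FPS
rhsTerm n = poch qS (powS qS 2) n ⊛ signS n ⊛ powS qS n
            ⊛ invS (poch (negS (powS qS 2)) (powS qS 2) n)

{-# OPTIONS --safe #-}

-- Write r(X) = -X(1-X)/(1+X). The n-th summand on the left is ∏_{j<n} r(q^{j+1}), and the
-- right-hand side is Φ(q) for Φ(X) = Σ_n (X;q²)_n (-X)^n / (-qX;q²)_n. Fine's functional equation
--   Φ(X) = 1 + r(X) + r(X) r(qX) Φ(q²X),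
-- iterated from X = q, gives Φ(q) = Σ_i (∏_{j<2i} r(q^{j+1})) (1 + r(q^{2i+1})): the left-hand
-- side with its terms grouped in pairs. For power series each truncation of the functional
-- equation holds exactly up to a remainder of order > M, which is what makes the iteration
-- meaningful coefficientwise.

module Submission where

open import Defs
open import Data.Bool.Base using (true; false)
open import Data.Bool.Properties using (T-≡; ¬-not)
open import Data.Integer as ℤ using (ℤ; 0ℤ; 1ℤ; -1ℤ)
import Data.Integer.Properties as ℤ
open import Data.Maybe using (Maybe; just; nothing)
open import Data.Nat.Base using (ℕ; zero; suc; _+_; _∸_; _≤_; _<_; z≤n; s≤s; _≤ᵇ_; _≡ᵇ_)
import Data.Nat.Properties as ℕ
open import Data.Product using (_,_)
open import Data.Sum using (inj₁; inj₂)
open import Function.Bundles using (Equivalence)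
open import Relation.Binary.PropositionalEquality
  using (_≡_; refl; sym; trans; cong; cong₂; module ≡-Reasoning)
open import Relation.Nullary using (yes; no)
open import Algebra.Bundles using (CommutativeRing)
open import Algebra.Structures using (IsCommutativeRing)
import Algebra.Construct.Pointwise as Pointwise
import Relation.Binary.Reasoning.Setoid
import Algebra.Solver.Ring
open import Data.Integer.Tactic.RingSolver using (solve-∀)
import Algebra.Solver.Ring.AlmostCommutativeRing as ACR
open import Algebra.Properties.CommutativeSemigroup ℤ.+-commutativeSemigroup
  using (interchange)

sumTo-cong : ∀ n {f g : ℕ → ℤ} → (∀ i → i ≤ n → f i ≡ g i) → sumTo n f ≡ sumTo n g
sumTo-cong zero    f≡g = f≡g 0 z≤n
sumTo-cong (suc n) f≡g =
  cong₂ ℤ._+_ (sumTo-cong n (λ i i≤n → f≡g i (ℕ.m≤n⇒m≤1+n i≤n))) (f≡g (suc n) ℕ.≤-refl)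

sumTo-zero : ∀ n {f : ℕ → ℤ} → (∀ i → i ≤ n → f i ≡ 0ℤ) → sumTo n f ≡ 0ℤ
sumTo-zero zero    f≡0 = f≡0 0 z≤n
sumTo-zero (suc n) f≡0 =
  cong₂ ℤ._+_ (sumTo-zero n (λ i i≤n → f≡0 i (ℕ.m≤n⇒m≤1+n i≤n))) (f≡0 (suc n) ℕ.≤-refl)

sumTo-suc : ∀ n (f : ℕ → ℤ) → sumTo (suc n) f ≡ f 0 ℤ.+ sumTo n (λ i → f (suc i))
sumTo-suc zero    f = refl
sumTo-suc (suc n) f =
  trans (cong (ℤ._+ f (suc (suc n))) (sumTo-suc n f)) (ℤ.+-assoc (f 0) _ _)

sumTo-+ : ∀ n (f g : ℕ → ℤ) → sumTo n (λ i → f i ℤ.+ g i) ≡ sumTo n f ℤ.+ sumTo n g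
sumTo-+ zero    f g = refl
sumTo-+ (suc n) f g =
  trans (cong (ℤ._+ (f (suc n) ℤ.+ g (suc n))) (sumTo-+ n f g))
        (interchange (sumTo n f) (sumTo n g) (f (suc n)) (g (suc n)))

*-distribˡ-sumTo : ∀ n c (f : ℕ → ℤ) → c ℤ.* sumTo n f ≡ sumTo n (λ i → c ℤ.* f i)
*-distribˡ-sumTo zero    c f = refl
*-distribˡ-sumTo (suc n) c f =
  trans (ℤ.*-distribˡ-+ c (sumTo n f) (f (suc n)))
        (cong (ℤ._+ c ℤ.* f (suc n)) (*-distribˡ-sumTo n c f))

sumTo-reverse : ∀ n (f : ℕ → ℤ) → sumTo n f ≡ sumTo n (λ i → f (n ∸ i))
sumTo-reverse zero    f = refl
sumTo-reverse (suc n) f =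
  trans (ℤ.+-comm (sumTo n f) (f (suc n)))
        (trans (cong (λ z → f (suc n) ℤ.+ z) (sumTo-reverse n f))
               (sym (sumTo-suc n (λ i → f (suc n ∸ i)))))

-- The ring of formal power series

infix 4 _≈_
_≈_ : FPS → FPS → Set
f ≈ g = ∀ k → f k ≡ g k

zeroS : FPS
zeroS _ = 0ℤ

const0≈zeroS : const 0ℤ ≈ zeroS
const0≈zeroS zero    = refl
const0≈zeroS (suc _) = refl

shiftS : FPS → FPS
shiftS f n = f (suc n)

scaleS : ℤ → FPS → FPS
scaleS c f n = c ℤ.* f n

⊛-suc : ∀ f g n → (f ⊛ g) (suc n) ≡ (scaleS (f 0) (shiftS g) ⊕ shiftS f ⊛ g) n
⊛-suc f g n = sumTo-suc n _

⊛-cong : ∀ {f f′ g g′} → f ≈ f′ → g ≈ g′ → f ⊛ g ≈ f′ ⊛ g′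
⊛-cong f≈f′ g≈g′ n = sumTo-cong n (λ i _ → cong₂ ℤ._*_ (f≈f′ i) (g≈g′ (n ∸ i)))

⊛-comm : ∀ f g → f ⊛ g ≈ g ⊛ f
⊛-comm f g n = trans (sumTo-reverse n _) (sumTo-cong n λ i i≤n →
  trans (cong (λ j → f (n ∸ i) ℤ.* g j) (ℕ.m∸[m∸n]≡n i≤n)) (ℤ.*-comm (f (n ∸ i)) (g i)))

⊛-distribˡ-⊕ : ∀ f g h → f ⊛ (g ⊕ h) ≈ f ⊛ g ⊕ f ⊛ h
⊛-distribˡ-⊕ f g h n =
  trans (sumTo-cong n (λ i _ → ℤ.*-distribˡ-+ (f i) (g (n ∸ i)) (h (n ∸ i)))) (sumTo-+ n _ _)

⊛-distribʳ-⊕ : ∀ f g h → (g ⊕ h) ⊛ f ≈ g ⊛ f ⊕ h ⊛ f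
⊛-distribʳ-⊕ f g h n = trans (⊛-comm (g ⊕ h) f n)
  (trans (⊛-distribˡ-⊕ f g h n) (cong₂ ℤ._+_ (⊛-comm f g n) (⊛-comm f h n)))

⊛-identityˡ : ∀ f → oneS ⊛ f ≈ f
⊛-identityˡ f zero    = ℤ.*-identityˡ (f 0)
⊛-identityˡ f (suc n) = trans (⊛-suc oneS f n)
  (trans (cong₂ ℤ._+_ (ℤ.*-identityˡ (f (suc n))) (sumTo-zero n (λ i _ → ℤ.*-zeroˡ (f (n ∸ i)))))
         (ℤ.+-identityʳ _))

⊛-identityʳ : ∀ f → f ⊛ oneS ≈ f
⊛-identityʳ f n = trans (⊛-comm f oneS n) (⊛-identityˡ f n)

scaleS-⊛ : ∀ c f g → scaleS c f ⊛ g ≈ scaleS c (f ⊛ g)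
scaleS-⊛ c f g n =
  trans (sumTo-cong n (λ i _ → ℤ.*-assoc c (f i) (g (n ∸ i)))) (sym (*-distribˡ-sumTo n c _))

⊛-assoc : ∀ f g h → (f ⊛ g) ⊛ h ≈ f ⊛ (g ⊛ h)
⊛-assoc f g h zero    = ℤ.*-assoc (f 0) (g 0) (h 0)
⊛-assoc f g h (suc n) = begin
  ((f ⊛ g) ⊛ h) (suc n)
    ≡⟨ ⊛-suc (f ⊛ g) h n ⟩
  a ℤ.* b ℤ.* h (suc n) ℤ.+ (shiftS (f ⊛ g) ⊛ h) n
    ≡⟨ cong (λ z → a ℤ.* b ℤ.* h (suc n) ℤ.+ z) (⊛-cong {g = h} (⊛-suc f g) (λ _ → refl) n) ⟩
  a ℤ.* b ℤ.* h (suc n) ℤ.+ ((scaleS a (shiftS g) ⊕ shiftS f ⊛ g) ⊛ h) n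
    ≡⟨ cong (λ z → a ℤ.* b ℤ.* h (suc n) ℤ.+ z)
            (⊛-distribʳ-⊕ h (scaleS a (shiftS g)) (shiftS f ⊛ g) n) ⟩
  a ℤ.* b ℤ.* h (suc n) ℤ.+ ((scaleS a (shiftS g) ⊛ h) n ℤ.+ ((shiftS f ⊛ g) ⊛ h) n)
    ≡⟨ cong (λ z → a ℤ.* b ℤ.* h (suc n) ℤ.+ z)
            (cong₂ ℤ._+_ (scaleS-⊛ a (shiftS g) h n) (⊛-assoc (shiftS f) g h n)) ⟩
  a ℤ.* b ℤ.* h (suc n) ℤ.+ (a ℤ.* (shiftS g ⊛ h) n ℤ.+ (shiftS f ⊛ (g ⊛ h)) n)
    ≡⟨ regroup a b (h (suc n)) ((shiftS g ⊛ h) n) ((shiftS f ⊛ (g ⊛ h)) n) ⟩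
  a ℤ.* (b ℤ.* h (suc n) ℤ.+ (shiftS g ⊛ h) n) ℤ.+ (shiftS f ⊛ (g ⊛ h)) n
    ≡⟨ cong (λ z → a ℤ.* z ℤ.+ (shiftS f ⊛ (g ⊛ h)) n) (sym (⊛-suc g h n)) ⟩
  a ℤ.* (g ⊛ h) (suc n) ℤ.+ (shiftS f ⊛ (g ⊛ h)) n
    ≡⟨ sym (⊛-suc f (g ⊛ h) n) ⟩
  (f ⊛ (g ⊛ h)) (suc n) ∎
  where
  open ≡-Reasoning
  a = f 0
  b = g 0
  regroup : ∀ a b c d e → a ℤ.* b ℤ.* c ℤ.+ (a ℤ.* d ℤ.+ e) ≡ a ℤ.* (b ℤ.* c ℤ.+ d) ℤ.+ e
  regroup = solve-∀

⊛-isCommutativeRing : IsCommutativeRing _≈_ _⊕_ _⊛_ negS zeroS oneS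
⊛-isCommutativeRing = record
  { isRing = record
    { +-isAbelianGroup = Pointwise.isAbelianGroup ℕ ℤ.+-0-isAbelianGroup
    ; *-cong           = ⊛-cong
    ; *-assoc          = ⊛-assoc
    ; *-identity       = ⊛-identityˡ , ⊛-identityʳ
    ; distrib          = ⊛-distribˡ-⊕ , ⊛-distribʳ-⊕
    }
  ; *-comm = ⊛-comm
  }

fps : CommutativeRing _ _
fps = record { isCommutativeRing = ⊛-isCommutativeRing }

open CommutativeRing fps
  using (+-cong; +-congˡ; +-congʳ; +-assoc; *-congˡ; *-congʳ; -‿cong; setoid)
  renaming (refl to ≈-refl; sym to ≈-sym; trans to ≈-trans; reflexive to ≈-reflexive)
module ≈-Reasoning = Relation.Binary.Reasoning.Setoid setoid

const-homomorphism :
  CommutativeRing.rawRing ℤ.+-*-commutativeRing ACR.-Raw-AlmostCommutative⟶ ACR.fromCommutativeRing fps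
const-homomorphism = record
  { ⟦_⟧    = const
  ; +-homo = λ a b → λ { zero → refl ; (suc _) → refl }
  ; *-homo = λ a b → λ { zero → refl ; (suc k) → sym (trans (⊛-suc (const a) (const b) k)
                          (cong₂ ℤ._+_ (ℤ.*-zeroʳ a) (sumTo-zero k (λ _ _ → refl)))) }
  ; -‿homo = λ a → λ { zero → refl ; (suc _) → refl }
  ; 0-homo = λ { zero → refl ; (suc _) → refl }
  ; 1-homo = λ _ → refl
  }

const-≟ : ∀ a b → Maybe (const a ≈ const b)
const-≟ a b with a ℤ.≟ b
... | yes refl = just (λ _ → refl)
... | no  _    = nothing

open Algebra.Solver.Ring _ (ACR.fromCommutativeRing fps) const-homomorphism const-≟
  using (solve; _:=_; _:+_; _:*_; :-_; _:-_; _:^_; con)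

-- Inverses of series with constant term 1

≤ᵇ-true : ∀ {k n} → k ≤ n → (k ≤ᵇ n) ≡ true
≤ᵇ-true k≤n = Equivalence.to T-≡ (ℕ.≤⇒≤ᵇ k≤n)

1+n≤ᵇn-false : ∀ n → (suc n ≤ᵇ n) ≡ false
1+n≤ᵇn-false n = ¬-not (λ eq → ℕ.n≮n n (ℕ.≤ᵇ⇒≤ (suc n) n (Equivalence.from T-≡ eq)))

≡ᵇ-refl : ∀ n → (n ≡ᵇ n) ≡ true
≡ᵇ-refl n = Equivalence.to T-≡ (ℕ.≡⇒≡ᵇ n n refl)

module _ (f : FPS) where

  invAux≡invS : ∀ n {k} → k ≤ n → invAux f n k ≡ invS f k
  invAux≡invS zero    z≤n = refl
  invAux≡invS (suc n) k≤1+n with ℕ.m≤n⇒m<n∨m≡n k≤1+n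
  ... | inj₁ (s≤s k≤n) rewrite ≤ᵇ-true k≤n = invAux≡invS n k≤n
  ... | inj₂ refl = refl

  invS-suc : ∀ n → invS f (suc n) ≡ ℤ.- (shiftS f ⊛ invS f) n
  invS-suc n rewrite 1+n≤ᵇn-false n | ≡ᵇ-refl n =
    cong ℤ.-_ (sumTo-cong n (λ j _ → cong (f (suc j) ℤ.*_) (invAux≡invS n (ℕ.m∸n≤m n j))))

  invS-inverseʳ : f 0 ≡ 1ℤ → f ⊛ invS f ≈ oneS
  invS-inverseʳ f₀≡1 zero    rewrite f₀≡1 = refl
  invS-inverseʳ f₀≡1 (suc n) rewrite ⊛-suc f (invS f) n | f₀≡1 | invS-suc n =
    trans (cong (ℤ._+ (shiftS f ⊛ invS f) n) (ℤ.*-identityˡ (ℤ.- (shiftS f ⊛ invS f) n)))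
          (ℤ.+-inverseˡ ((shiftS f ⊛ invS f) n))

  invS-unique : ∀ {g} → f 0 ≡ 1ℤ → f ⊛ g ≈ oneS → invS f ≈ g
  invS-unique {g} f₀≡1 f⊛g≈1 = begin
    invS f                ≈⟨ ≈-sym (⊛-identityʳ (invS f)) ⟩
    invS f ⊛ oneS         ≈⟨ *-congˡ {invS f} (≈-sym f⊛g≈1) ⟩
    invS f ⊛ (f ⊛ g)      ≈⟨ solve 3 (λ i f′ g′ → i :* (f′ :* g′) := (f′ :* i) :* g′)
                                     ≈-refl (invS f) f g ⟩
    (f ⊛ invS f) ⊛ g      ≈⟨ *-congʳ {g} (invS-inverseʳ f₀≡1) ⟩
    oneS ⊛ g              ≈⟨ ⊛-identityˡ g ⟩
    g                     ∎
    where open ≈-Reasoning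

invS-⊛ : ∀ {f g} → f 0 ≡ 1ℤ → g 0 ≡ 1ℤ → invS (f ⊛ g) ≈ invS f ⊛ invS g
invS-⊛ {f} {g} f₀≡1 g₀≡1 = invS-unique (f ⊛ g) (cong₂ ℤ._*_ f₀≡1 g₀≡1) (begin
  (f ⊛ g) ⊛ (invS f ⊛ invS g)
    ≈⟨ solve 4 (λ f′ g′ i j → (f′ :* g′) :* (i :* j) := (f′ :* i) :* (g′ :* j))
               ≈-refl f g (invS f) (invS g) ⟩
  (f ⊛ invS f) ⊛ (g ⊛ invS g)
    ≈⟨ ⊛-cong (invS-inverseʳ f f₀≡1) (invS-inverseʳ g g₀≡1) ⟩
  oneS ⊛ oneS
    ≈⟨ ⊛-identityˡ oneS ⟩
  oneS ∎)
  where open ≈-Reasoning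

invS-cong : ∀ {f g} → g 0 ≡ 1ℤ → f ≈ g → invS f ≈ invS g
invS-cong {f} {g} g₀≡1 f≈g =
  invS-unique f (trans (f≈g 0) g₀≡1) (≈-trans (*-congʳ {invS g} f≈g) (invS-inverseʳ g g₀≡1))

invS-oneS : invS oneS ≈ oneS
invS-oneS = invS-unique oneS refl (⊛-identityˡ oneS)

-- Orders and agreement modulo q^m

infix 4 _≈[_]_ ord_≥_

_≈[_]_ : FPS → ℕ → FPS → Set
f ≈[ m ] g = ∀ k → k < m → f k ≡ g k

ord_≥_ : FPS → ℕ → Set
ord f ≥ a = f ≈[ a ] zeroS

≈⇒≈[] : ∀ {f g} m → f ≈ g → f ≈[ m ] g
≈⇒≈[] m f≈g k _ = f≈g k

≈[]-trans : ∀ {f g h m} → f ≈[ m ] g → g ≈[ m ] h → f ≈[ m ] h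
≈[]-trans f≈g g≈h k k<m = trans (f≈g k k<m) (g≈h k k<m)

⊕-congˡ-≈[] : ∀ h {f g m} → f ≈[ m ] g → h ⊕ f ≈[ m ] h ⊕ g
⊕-congˡ-≈[] h f≈g k k<m = cong (λ z → h k ℤ.+ z) (f≈g k k<m)

⊕-ord-≈[] : ∀ f {e m} → ord e ≥ m → f ⊕ e ≈[ m ] f
⊕-ord-≈[] f e≈0 k k<m = trans (cong (λ z → f k ℤ.+ z) (e≈0 k k<m)) (ℤ.+-identityʳ (f k))

ord-resp : ∀ {f g a} → f ≈ g → ord f ≥ a → ord g ≥ a
ord-resp f≈g f≈0 k k<a = trans (sym (f≈g k)) (f≈0 k k<a)

ord-weaken : ∀ {f a b} → b ≤ a → ord f ≥ a → ord f ≥ b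
ord-weaken b≤a f≈0 k k<b = f≈0 k (ℕ.<-≤-trans k<b b≤a)

ord-≥0 : ∀ f → ord f ≥ 0
ord-≥0 f k ()

ord-negS : ∀ {f a} → ord f ≥ a → ord negS f ≥ a
ord-negS f≈0 k k<a = cong ℤ.-_ (f≈0 k k<a)

ord-⊛ : ∀ {f g a b} → ord f ≥ a → ord g ≥ b → ord (f ⊛ g) ≥ a + b
ord-⊛ {f} {g} {a} {b} f≈0 g≈0 n n<a+b = sumTo-zero n term≡0
  where
  term≡0 : ∀ i → i ≤ n → f i ℤ.* g (n ∸ i) ≡ 0ℤ
  term≡0 i i≤n with i ℕ.<? a
  ... | yes i<a = trans (cong (ℤ._* g (n ∸ i)) (f≈0 i i<a)) (ℤ.*-zeroˡ (g (n ∸ i)))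
  ... | no  i≮a = trans (cong (f i ℤ.*_) (g≈0 (n ∸ i) n∸i<b)) (ℤ.*-zeroʳ (f i))
    where
    n∸i<b : n ∸ i < b
    n∸i<b = ℕ.+-cancelˡ-< i (n ∸ i) b (begin-strict
      i + (n ∸ i) ≡⟨ ℕ.m+[n∸m]≡n i≤n ⟩
      n           <⟨ n<a+b ⟩
      a + b       ≤⟨ ℕ.+-monoˡ-≤ b (ℕ.≮⇒≥ i≮a) ⟩
      i + b       ∎)
      where open ℕ.≤-Reasoning

ord-⊛ˡ : ∀ {f a} g → ord f ≥ a → ord (f ⊛ g) ≥ a
ord-⊛ˡ {f} {a} g f≈0 =
  ord-weaken (ℕ.≤-reflexive (sym (ℕ.+-identityʳ a))) (ord-⊛ f≈0 (ord-≥0 g))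

ord-⊛ʳ : ∀ {g a} f → ord g ≥ a → ord (f ⊛ g) ≥ a
ord-⊛ʳ {g} f g≈0 = ord-resp (⊛-comm g f) (ord-⊛ˡ f g≈0)

ord-powS : ∀ {f} n → ord f ≥ 1 → ord (powS f n) ≥ n
ord-powS zero    f≈0 = ord-≥0 oneS
ord-powS (suc n) f≈0 = ord-⊛ f≈0 (ord-powS n f≈0)

ord-prodS : ∀ n {F} → (∀ j → ord F j ≥ 1) → ord (prodS n F) ≥ n
ord-prodS zero    {F} F≈0 = ord-≥0 oneS
ord-prodS (suc n) {F} F≈0 =
  ord-weaken (ℕ.≤-reflexive (ℕ.+-comm 1 n)) (ord-⊛ (ord-prodS n F≈0) (F≈0 n))

ord-qS : ord qS ≥ 1
ord-qS zero _ = refl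
ord-qS (suc k) (s≤s ())

partialSum : ℕ → (ℕ → FPS) → FPS
partialSum zero    T = zeroS
partialSum (suc n) T = partialSum n T ⊕ T n

partialSum-cong : ∀ n {T T′} → (∀ i → T i ≈ T′ i) → partialSum n T ≈ partialSum n T′
partialSum-cong zero    T≈T′ = ≈-refl
partialSum-cong (suc n) T≈T′ = +-cong (partialSum-cong n T≈T′) (T≈T′ n)

partialSum-suc : ∀ n T → partialSum (suc n) T ≈ T 0 ⊕ partialSum n (λ i → T (suc i))
partialSum-suc zero    T k = trans (ℤ.+-identityˡ (T 0 k)) (sym (ℤ.+-identityʳ (T 0 k)))
partialSum-suc (suc n) T k =
  trans (cong (ℤ._+ T (suc n) k) (partialSum-suc n T k)) (ℤ.+-assoc (T 0 k) _ _)

partialSum-pairs : ∀ n T → partialSum (n + n) T ≈ partialSum n (λ i → T (i + i) ⊕ T (suc (i + i)))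
partialSum-pairs zero    T = ≈-refl
partialSum-pairs (suc n) T k rewrite ℕ.+-suc n n =
  trans (cong (λ z → z ℤ.+ T (n + n) k ℤ.+ T (suc (n + n)) k) (partialSum-pairs n T k))
        (ℤ.+-assoc (partialSum n _ k) (T (n + n) k) (T (suc (n + n)) k))

partialSum≡sumTo : ∀ m T k → partialSum (suc m) T k ≡ sumTo m (λ n → T n k)
partialSum≡sumTo zero    T k = ℤ.+-identityˡ (T 0 k)
partialSum≡sumTo (suc m) T k = cong (ℤ._+ T (suc m) k) (partialSum≡sumTo m T k)

sumSeries-cong : ∀ {T T′} N → (∀ n → T n ≈ T′ n) → sumSeries T N ≡ sumSeries T′ N
sumSeries-cong N T≈T′ = sumTo-cong N (λ n _ → T≈T′ n N)

sumSeries-truncate : ∀ {T N} m → (∀ n → ord T n ≥ n) → N < m → sumSeries T N ≡ partialSum m T N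
sumSeries-truncate {T} {N} (suc m) ord-T (s≤s N≤m) with ℕ.m≤n⇒m<n∨m≡n N≤m
... | inj₁ N<m = trans (sumSeries-truncate m ord-T N<m)
  (sym (trans (cong (λ z → partialSum m T N ℤ.+ z) (ord-T m N N<m)) (ℤ.+-identityʳ _)))
... | inj₂ refl = sym (partialSum≡sumTo N T N)

module _ (S e : ℕ → ℕ → FPS) (c d : ℕ → FPS)
         (recurrence : ∀ k m → S k (suc m) ≈ c k ⊕ d k ⊛ S (suc k) m ⊕ e k m)
         (ord-d : ∀ k → ord d k ≥ 1) (ord-e : ∀ k m → ord e k m ≥ suc m) where

  unfold-recurrence : ∀ m k →
    prodS k d ⊛ S k m ≈[ k + m ] partialSum m (λ i → prodS (k + i) d ⊛ c (k + i))
  unfold-recurrence zero    k = ord-⊛ (ord-prodS k ord-d) (ord-≥0 (S k 0))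
  unfold-recurrence (suc m) k =
    ≈[]-trans (≈⇒≈[] (k + suc m) expand)
    (≈[]-trans (⊕-ord-≈[] (E ⊛ c k ⊕ E′ ⊛ S (suc k) m) (ord-⊛ (ord-prodS k ord-d) (ord-e k m)))
    (≈[]-trans induction (≈⇒≈[] (k + suc m) regroup)))
    where
    open ≈-Reasoning
    E E′ : FPS
    E  = prodS k d
    E′ = prodS (suc k) d
    later : FPS
    later = partialSum m (λ i → prodS (suc k + i) d ⊛ c (suc k + i))
    expand : E ⊛ S k (suc m) ≈ E ⊛ c k ⊕ E′ ⊛ S (suc k) m ⊕ E ⊛ e k m
    expand = begin
      E ⊛ S k (suc m)
        ≈⟨ *-congˡ {E} (recurrence k m) ⟩
      E ⊛ (c k ⊕ d k ⊛ S (suc k) m ⊕ e k m)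
        ≈⟨ solve 5 (λ E c′ d′ s e′ → E :* (c′ :+ d′ :* s :+ e′)
                                    := E :* c′ :+ E :* d′ :* s :+ E :* e′)
             ≈-refl E (c k) (d k) (S (suc k) m) (e k m) ⟩
      E ⊛ c k ⊕ E′ ⊛ S (suc k) m ⊕ E ⊛ e k m ∎
    induction : E ⊛ c k ⊕ E′ ⊛ S (suc k) m ≈[ k + suc m ] E ⊛ c k ⊕ later
    induction rewrite ℕ.+-suc k m = ⊕-congˡ-≈[] (E ⊛ c k) (unfold-recurrence m (suc k))
    regroup : E ⊛ c k ⊕ later ≈ partialSum (suc m) (λ i → prodS (k + i) d ⊛ c (k + i))
    regroup = ≈-sym (≈-trans (partialSum-suc m _) (+-cong
      (≈-reflexive (cong (λ j → prodS j d ⊛ c j) (ℕ.+-identityʳ k)))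
      (partialSum-cong m (λ i → ≈-reflexive (cong (λ j → prodS j d ⊛ c j) (ℕ.+-suc k i))))))

-- q-Pochhammer symbols and Fine's functional equation

ord≥1⇒coeff₀≡0 : ∀ {f} → ord f ≥ 1 → f 0 ≡ 0ℤ
ord≥1⇒coeff₀≡0 f≈0 = f≈0 0 (s≤s z≤n)

1⊕-coeff₀ : ∀ f → f 0 ≡ 0ℤ → (oneS ⊕ f) 0 ≡ 1ℤ
1⊕-coeff₀ f f₀≡0 = cong (λ z → 1ℤ ℤ.+ z) f₀≡0

1⊖-coeff₀ : ∀ f → f 0 ≡ 0ℤ → (oneS ⊖ f) 0 ≡ 1ℤ
1⊖-coeff₀ f f₀≡0 = cong (λ z → 1ℤ ℤ.+ ℤ.- z) f₀≡0

⊛-coeff₀ : ∀ f g → f 0 ≡ 0ℤ → (f ⊛ g) 0 ≡ 0ℤ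
⊛-coeff₀ f g f₀≡0 = trans (cong (ℤ._* g 0) f₀≡0) (ℤ.*-zeroˡ (g 0))

powS-cong : ∀ {f g} n → f ≈ g → powS f n ≈ powS g n
powS-cong zero    f≈g = ≈-refl
powS-cong (suc n) f≈g = ⊛-cong f≈g (powS-cong n f≈g)

powS-⊛ : ∀ f g n → powS (f ⊛ g) n ≈ powS f n ⊛ powS g n
powS-⊛ f g zero    = ≈-sym (⊛-identityˡ oneS)
powS-⊛ f g (suc n) = ≈-trans (*-congˡ {f ⊛ g} (powS-⊛ f g n))
  (solve 4 (λ f g a b → (f :* g) :* (a :* b) := (f :* a) :* (g :* b)) ≈-refl f g (powS f n) (powS g n))

powS-+ : ∀ f m n → powS f (m + n) ≈ powS f m ⊛ powS f n
powS-+ f zero    n = ≈-sym (⊛-identityˡ (powS f n))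
powS-+ f (suc m) n =
  ≈-trans (*-congˡ {f} (powS-+ f m n)) (≈-sym (⊛-assoc f (powS f m) (powS f n)))

prodS-cong : ∀ n {F G} → (∀ j → F j ≈ G j) → prodS n F ≈ prodS n G
prodS-cong zero    F≈G = ≈-refl
prodS-cong (suc n) F≈G = ⊛-cong (prodS-cong n F≈G) (F≈G n)

prodS-pairs : ∀ n F → prodS (n + n) F ≈ prodS n (λ j → F (j + j) ⊛ F (suc (j + j)))
prodS-pairs zero    F = ≈-refl
prodS-pairs (suc n) F rewrite ℕ.+-suc n n =
  ≈-trans (*-congʳ {F (suc (n + n))} (*-congʳ {F (n + n)} (prodS-pairs n F)))
          (⊛-assoc (prodS n _) (F (n + n)) (F (suc (n + n))))

poch-cong : ∀ {a a′} b n → a ≈ a′ → poch a b n ≈ poch a′ b n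
poch-cong b n a≈a′ = prodS-cong n (λ k → +-congˡ {oneS} (-‿cong (*-congʳ {powS b k} a≈a′)))

poch-coeff₀ : ∀ a b n → a 0 ≡ 0ℤ → poch a b n 0 ≡ 1ℤ
poch-coeff₀ a b zero    a₀≡0 = refl
poch-coeff₀ a b (suc n) a₀≡0 =
  cong₂ ℤ._*_ (poch-coeff₀ a b n a₀≡0) (1⊖-coeff₀ (a ⊛ powS b n) (⊛-coeff₀ a (powS b n) a₀≡0))

poch-suc : ∀ a b n → poch a b (suc n) ≈ (oneS ⊖ a) ⊛ poch (a ⊛ b) b n
poch-suc a b zero    =
  solve 1 (λ a → con 1ℤ :* (con 1ℤ :- a :* con 1ℤ) := (con 1ℤ :- a) :* con 1ℤ) ≈-refl a
poch-suc a b (suc n) =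
  ≈-trans (*-congʳ {oneS ⊖ a ⊛ (b ⊛ powS b n)} (poch-suc a b n))
          (solve 4 (λ a b bⁿ P → ((con 1ℤ :- a) :* P) :* (con 1ℤ :- a :* (b :* bⁿ))
                               := (con 1ℤ :- a) :* (P :* (con 1ℤ :- (a :* b) :* bⁿ)))
                 ≈-refl a b (powS b n) (poch (a ⊛ b) b n))

invS-poch-suc : ∀ {a} b n → a 0 ≡ 0ℤ →
  invS (poch (a ⊛ b) b n) ≈ (oneS ⊖ a) ⊛ invS (poch a b (suc n))
invS-poch-suc {a} b n a₀≡0 =
  invS-unique (poch (a ⊛ b) b n) (poch-coeff₀ (a ⊛ b) b n (⊛-coeff₀ a b a₀≡0)) (begin
  poch (a ⊛ b) b n ⊛ ((oneS ⊖ a) ⊛ invS (poch a b (suc n)))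
    ≈⟨ solve 3 (λ P a I → P :* ((con 1ℤ :- a) :* I) := ((con 1ℤ :- a) :* P) :* I) ≈-refl
         (poch (a ⊛ b) b n) a (invS (poch a b (suc n))) ⟩
  ((oneS ⊖ a) ⊛ poch (a ⊛ b) b n) ⊛ invS (poch a b (suc n))
    ≈⟨ *-congʳ {invS (poch a b (suc n))} (≈-sym (poch-suc a b n)) ⟩
  poch a b (suc n) ⊛ invS (poch a b (suc n))
    ≈⟨ invS-inverseʳ (poch a b (suc n)) (poch-coeff₀ a b (suc n) a₀≡0) ⟩
  oneS ∎)
  where open ≈-Reasoning

q² : FPS
q² = powS qS 2

ratio : FPS → FPS
ratio X = (oneS ⊖ X) ⊛ negS X ⊛ invS (oneS ⊕ X)

fineTerm : FPS → ℕ → FPS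
fineTerm X n = poch X q² n ⊛ powS (negS X) n ⊛ invS (poch (negS (qS ⊛ X)) q² n)

fineError : FPS → ℕ → FPS
fineError X n =
  negS (ratio X ⊛ poch (X ⊛ q²) q² n ⊛ powS (negS X) n ⊛ invS (poch (negS (qS ⊛ X)) q² n))

-- fineError-step with the common factor (Xq²;q²)_M (-X)^M / (-qX;q²)_M cancelled, where s = q^(2M)
-- and u₀, u₁, v are the inverses of 1 + X, 1 + qX, 1 + qXs. Once u₀ and v are traded for these
-- inverses, what remains is a polynomial identity in X, q and s.
fineError-step-core : ∀ X q s u₀ u₁ v →
  (oneS ⊕ X) ⊛ u₀ ≈ oneS → (oneS ⊕ q ⊛ X) ⊛ u₁ ≈ oneS → (oneS ⊕ q ⊛ X ⊛ s) ⊛ v ≈ oneS →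
  negS ((oneS ⊖ X) ⊛ negS X ⊛ u₀) ⊕ (oneS ⊖ X) ⊛ negS X ⊛ v
  ≈ (oneS ⊖ X) ⊛ negS X ⊛ u₀ ⊛ ((oneS ⊖ q ⊛ X) ⊛ negS (q ⊛ X) ⊛ u₁) ⊛ (oneS ⊕ q ⊛ X) ⊛ s ⊛ v
    ⊕ negS ((oneS ⊖ X) ⊛ negS X ⊛ u₀ ⊛ (oneS ⊖ q ⊛ q ⊛ X ⊛ s) ⊛ negS X ⊛ v)
fineError-step-core X q s u₀ u₁ v h₀ h₁ h₂ = begin
  negS (a ⊛ u₀) ⊕ a ⊛ v
    ≈⟨ +-cong (-‿cong (*-congˡ {a} u₀≈)) (*-congˡ {a} v≈) ⟩
  negS (a ⊛ (u₀ ⊛ ((oneS ⊕ q ⊛ X ⊛ s) ⊛ v))) ⊕ a ⊛ ((oneS ⊕ X) ⊛ u₀ ⊛ v)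
    ≈⟨ solve 6 (λ X q s u₀ u₁ v → let a = (con 1ℤ :- X) :* (:- X) in
         :- (a :* (u₀ :* ((con 1ℤ :+ q :* X :* s) :* v))) :+ a :* ((con 1ℤ :+ X) :* u₀ :* v)
         := a :* u₀ :* ((con 1ℤ :- q :* X) :* (:- (q :* X))) :* s :* v :* con 1ℤ
            :+ :- (a :* u₀ :* (con 1ℤ :- q :* q :* X :* s) :* (:- X) :* v))
       ≈-refl X q s u₀ u₁ v ⟩
  a ⊛ u₀ ⊛ b ⊛ s ⊛ v ⊛ oneS ⊕ c
    ≈⟨ +-congʳ {c} (*-congˡ {a ⊛ u₀ ⊛ b ⊛ s ⊛ v} (≈-sym h₁)) ⟩
  a ⊛ u₀ ⊛ b ⊛ s ⊛ v ⊛ ((oneS ⊕ q ⊛ X) ⊛ u₁) ⊕ c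
    ≈⟨ +-congʳ {c} (solve 7 (λ a u₀ b s v y u₁ → a :* u₀ :* b :* s :* v :* (y :* u₁)
                                                := a :* u₀ :* (b :* u₁) :* y :* s :* v)
                      ≈-refl a u₀ b s v (oneS ⊕ q ⊛ X) u₁) ⟩
  a ⊛ u₀ ⊛ (b ⊛ u₁) ⊛ (oneS ⊕ q ⊛ X) ⊛ s ⊛ v ⊕ c ∎
  where
  open ≈-Reasoning
  a b c : FPS
  a = (oneS ⊖ X) ⊛ negS X
  b = (oneS ⊖ q ⊛ X) ⊛ negS (q ⊛ X)
  c = negS (a ⊛ u₀ ⊛ (oneS ⊖ q ⊛ q ⊛ X ⊛ s) ⊛ negS X ⊛ v)
  u₀≈ : u₀ ≈ u₀ ⊛ ((oneS ⊕ q ⊛ X ⊛ s) ⊛ v)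
  u₀≈ = ≈-trans (≈-sym (⊛-identityʳ u₀)) (*-congˡ {u₀} (≈-sym h₂))
  v≈ : v ≈ (oneS ⊕ X) ⊛ u₀ ⊛ v
  v≈ = ≈-trans (≈-sym (⊛-identityˡ v)) (*-congʳ {v} (≈-sym h₀))

ord-ratio : ∀ {X} → ord X ≥ 1 → ord ratio X ≥ 1
ord-ratio {X} ord-X = ord-⊛ˡ (invS (oneS ⊕ X)) (ord-⊛ʳ (oneS ⊖ X) (ord-negS ord-X))

module _ {X} (ord-X : ord X ≥ 1) where

  private
    X₀≡0 : X 0 ≡ 0ℤ
    X₀≡0 = ord≥1⇒coeff₀≡0 ord-X

    qX₀≡0 : (qS ⊛ X) 0 ≡ 0ℤ
    qX₀≡0 = ⊛-coeff₀ qS X refl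

    -qX₀≡0 : negS (qS ⊛ X) 0 ≡ 0ℤ
    -qX₀≡0 = cong ℤ.-_ qX₀≡0

  fineError-step : ∀ M →
    fineError X M ⊕ fineTerm X (suc M)
    ≈ ratio X ⊛ ratio (qS ⊛ X) ⊛ fineTerm (X ⊛ q²) M ⊕ fineError X (suc M)
  fineError-step M = begin
    fineError X M ⊕ fineTerm X (suc M)
      ≈⟨ +-congˡ {fineError X M} term-suc ⟩
    negS (r ⊛ B ⊛ W ⊛ V) ⊕ (oneS ⊖ X) ⊛ B ⊛ (negS X ⊛ W) ⊛ (V ⊛ v)
      ≈⟨ solve 6 (λ X r B W V v → :- (r :* B :* W :* V) :+ (con 1ℤ :- X) :* B :* (:- X :* W) :* (V :* v)
                                 := B :* W :* V :* (:- r :+ (con 1ℤ :- X) :* (:- X) :* v))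
           ≈-refl X r B W V v ⟩
    B ⊛ W ⊛ V ⊛ (negS r ⊕ (oneS ⊖ X) ⊛ negS X ⊛ v)
      ≈⟨ *-congˡ {B ⊛ W ⊛ V} (fineError-step-core X qS s u₀ u₁ v
           (invS-inverseʳ (oneS ⊕ X) (1⊕-coeff₀ X X₀≡0))
           (invS-inverseʳ (oneS ⊕ qS ⊛ X) (1⊕-coeff₀ (qS ⊛ X) qX₀≡0)) h₂) ⟩
    B ⊛ W ⊛ V ⊛ (r ⊛ r′ ⊛ (oneS ⊕ qS ⊛ X) ⊛ s ⊛ v
                 ⊕ negS (r ⊛ (oneS ⊖ qS ⊛ qS ⊛ X ⊛ s) ⊛ negS X ⊛ v))
      ≈⟨ solve 9 (λ X q r r′ B W V s v →
             B :* W :* V :* (r :* r′ :* (con 1ℤ :+ q :* X) :* s :* v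
                             :+ :- (r :* (con 1ℤ :- q :* q :* X :* s) :* (:- X) :* v))
             := r :* r′ :* (B :* (W :* s) :* ((con 1ℤ :- (:- (q :* X))) :* (V :* v)))
                :+ :- (r :* (B :* (con 1ℤ :- X :* q :^ 2 :* s)) :* (:- X :* W) :* (V :* v)))
           ≈-refl X qS r r′ B W V s v ⟩
    r ⊛ r′ ⊛ (B ⊛ (W ⊛ s) ⊛ ((oneS ⊖ negS (qS ⊛ X)) ⊛ (V ⊛ v)))
      ⊕ negS (r ⊛ (B ⊛ (oneS ⊖ X ⊛ q² ⊛ s)) ⊛ (negS X ⊛ W) ⊛ (V ⊛ v))
      ≈˘⟨ +-cong (*-congˡ {r ⊛ r′} shifted-term) error-suc ⟩
    ratio X ⊛ ratio (qS ⊛ X) ⊛ fineTerm (X ⊛ q²) M ⊕ fineError X (suc M) ∎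
    where
    open ≈-Reasoning
    r r′ B W D V s v u₀ u₁ : FPS
    r  = ratio X
    r′ = ratio (qS ⊛ X)
    u₀ = invS (oneS ⊕ X)
    u₁ = invS (oneS ⊕ qS ⊛ X)
    B  = poch (X ⊛ q²) q² M
    W  = powS (negS X) M
    D  = poch (negS (qS ⊛ X)) q² M
    V  = invS D
    s  = powS q² M
    v  = invS (oneS ⊖ negS (qS ⊛ X) ⊛ s)

    D₀≡1 : D 0 ≡ 1ℤ
    D₀≡1 = poch-coeff₀ (negS (qS ⊛ X)) q² M -qX₀≡0

    last-factor₀≡1 : (oneS ⊖ negS (qS ⊛ X) ⊛ s) 0 ≡ 1ℤ
    last-factor₀≡1 = 1⊖-coeff₀ (negS (qS ⊛ X) ⊛ s) (⊛-coeff₀ (negS (qS ⊛ X)) s -qX₀≡0)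

    h₂ : (oneS ⊕ qS ⊛ X ⊛ s) ⊛ v ≈ oneS
    h₂ = ≈-trans (*-congʳ {v} (solve 3 (λ q X s → con 1ℤ :+ q :* X :* s := con 1ℤ :- (:- (q :* X)) :* s)
                                       ≈-refl qS X s))
                 (invS-inverseʳ (oneS ⊖ negS (qS ⊛ X) ⊛ s) last-factor₀≡1)

    denominator-suc : invS (poch (negS (qS ⊛ X)) q² (suc M)) ≈ V ⊛ v
    denominator-suc = invS-⊛ D₀≡1 last-factor₀≡1

    term-suc : fineTerm X (suc M) ≈ (oneS ⊖ X) ⊛ B ⊛ (negS X ⊛ W) ⊛ (V ⊛ v)
    term-suc = ⊛-cong (*-congʳ {negS X ⊛ W} (poch-suc X q² M)) denominator-suc

    error-suc : fineError X (suc M)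
              ≈ negS (r ⊛ (B ⊛ (oneS ⊖ X ⊛ q² ⊛ s)) ⊛ (negS X ⊛ W) ⊛ (V ⊛ v))
    error-suc = -‿cong (*-congˡ {r ⊛ (B ⊛ (oneS ⊖ X ⊛ q² ⊛ s)) ⊛ (negS X ⊛ W)} denominator-suc)

    shifted-term : fineTerm (X ⊛ q²) M ≈ B ⊛ (W ⊛ s) ⊛ ((oneS ⊖ negS (qS ⊛ X)) ⊛ (V ⊛ v))
    shifted-term = ⊛-cong (*-congˡ {B} shifted-power) shifted-denominator
      where
      shifted-power : powS (negS (X ⊛ q²)) M ≈ W ⊛ s
      shifted-power =
        ≈-trans (powS-cong M (solve 2 (λ X q → :- (X :* q :^ 2) := (:- X) :* q :^ 2) ≈-refl X qS))
                (powS-⊛ (negS X) q² M)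
      shifted-denominator : invS (poch (negS (qS ⊛ (X ⊛ q²))) q² M) ≈ (oneS ⊖ negS (qS ⊛ X)) ⊛ (V ⊛ v)
      shifted-denominator = begin
        invS (poch (negS (qS ⊛ (X ⊛ q²))) q² M)
          ≈⟨ invS-cong (poch-coeff₀ (negS (qS ⊛ X) ⊛ q²) q² M (⊛-coeff₀ (negS (qS ⊛ X)) q² -qX₀≡0))
               (poch-cong q² M (solve 2 (λ X q → :- (q :* (X :* q :^ 2)) := (:- (q :* X)) :* q :^ 2)
                                        ≈-refl X qS)) ⟩
        invS (poch (negS (qS ⊛ X) ⊛ q²) q² M)
          ≈⟨ invS-poch-suc q² M -qX₀≡0 ⟩
        (oneS ⊖ negS (qS ⊛ X)) ⊛ invS (poch (negS (qS ⊛ X)) q² (suc M))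
          ≈⟨ *-congˡ {oneS ⊖ negS (qS ⊛ X)} denominator-suc ⟩
        (oneS ⊖ negS (qS ⊛ X)) ⊛ (V ⊛ v) ∎

  fine-recurrence : ∀ M → partialSum (suc M) (fineTerm X)
    ≈ oneS ⊕ ratio X ⊕ ratio X ⊛ ratio (qS ⊛ X) ⊛ partialSum M (fineTerm (X ⊛ q²)) ⊕ fineError X M
  fine-recurrence zero = begin
    zeroS ⊕ oneS ⊛ oneS ⊛ invS oneS
      ≈⟨ +-cong (≈-sym const0≈zeroS) (*-congˡ {oneS ⊛ oneS} invS-oneS) ⟩
    const 0ℤ ⊕ oneS ⊛ oneS ⊛ oneS
      ≈⟨ solve 2 (λ r d → con 0ℤ :+ con 1ℤ :* con 1ℤ :* con 1ℤ
                         := con 1ℤ :+ r :+ d :* con 0ℤ :+ :- (r :* con 1ℤ :* con 1ℤ :* con 1ℤ))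
           ≈-refl (ratio X) (ratio X ⊛ ratio (qS ⊛ X)) ⟩
    oneS ⊕ ratio X ⊕ ratio X ⊛ ratio (qS ⊛ X) ⊛ const 0ℤ ⊕ negS (ratio X ⊛ oneS ⊛ oneS ⊛ oneS)
      ≈⟨ +-cong (+-congˡ {oneS ⊕ ratio X} (*-congˡ {ratio X ⊛ ratio (qS ⊛ X)} const0≈zeroS))
                (-‿cong (*-congˡ {ratio X ⊛ oneS ⊛ oneS} (≈-sym invS-oneS))) ⟩
    oneS ⊕ ratio X ⊕ ratio X ⊛ ratio (qS ⊛ X) ⊛ zeroS ⊕ fineError X 0 ∎
    where open ≈-Reasoning
  fine-recurrence (suc M) = begin
    partialSum (suc M) (fineTerm X) ⊕ fineTerm X (suc M)
      ≈⟨ +-congʳ {fineTerm X (suc M)} (fine-recurrence M) ⟩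
    c ⊕ d ⊛ S′ ⊕ fineError X M ⊕ fineTerm X (suc M)
      ≈⟨ +-assoc (c ⊕ d ⊛ S′) (fineError X M) (fineTerm X (suc M)) ⟩
    c ⊕ d ⊛ S′ ⊕ (fineError X M ⊕ fineTerm X (suc M))
      ≈⟨ +-congˡ {c ⊕ d ⊛ S′} (fineError-step M) ⟩
    c ⊕ d ⊛ S′ ⊕ (d ⊛ fineTerm (X ⊛ q²) M ⊕ fineError X (suc M))
      ≈⟨ solve 5 (λ c d S t e → c :+ d :* S :+ (d :* t :+ e) := c :+ d :* (S :+ t) :+ e)
           ≈-refl c d S′ (fineTerm (X ⊛ q²) M) (fineError X (suc M)) ⟩
    c ⊕ d ⊛ (S′ ⊕ fineTerm (X ⊛ q²) M) ⊕ fineError X (suc M) ∎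
    where
    open ≈-Reasoning
    c d S′ : FPS
    c  = oneS ⊕ ratio X
    d  = ratio X ⊛ ratio (qS ⊛ X)
    S′ = partialSum M (fineTerm (X ⊛ q²))

  ord-fineTerm : ∀ n → ord fineTerm X n ≥ n
  ord-fineTerm n = ord-⊛ˡ (invS (poch (negS (qS ⊛ X)) q² n))
    (ord-⊛ʳ (poch X q² n) (ord-powS n (ord-negS ord-X)))

  ord-fineError : ∀ n → ord fineError X n ≥ suc n
  ord-fineError n = ord-negS (ord-⊛ˡ (invS (poch (negS (qS ⊛ X)) q² n))
    (ord-⊛ (ord-⊛ˡ (poch (X ⊛ q²) q² n) (ord-ratio ord-X)) (ord-powS n (ord-negS ord-X))))

ratio-cong : ∀ {X Y} → ord Y ≥ 1 → X ≈ Y → ratio X ≈ ratio Y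
ratio-cong {X} {Y} ord-Y X≈Y =
  ⊛-cong (⊛-cong (+-congˡ {oneS} (-‿cong X≈Y)) (-‿cong X≈Y))
         (invS-cong (1⊕-coeff₀ Y (ord≥1⇒coeff₀≡0 ord-Y)) (+-congˡ {oneS} X≈Y))

-- The two sides of the identity

-- fineX k = q^(2k+1), built so that fineX (suc k) is literally the argument X ⊛ q² of fine-recurrence.
fineX : ℕ → FPS
fineX zero    = qS
fineX (suc k) = fineX k ⊛ q²

fineX≈powS : ∀ k → fineX k ≈ powS qS (suc (k + k))
fineX≈powS zero    = ≈-sym (⊛-identityʳ qS)
fineX≈powS (suc k) rewrite ℕ.+-suc k k =
  ≈-trans (*-congʳ {q²} (fineX≈powS k))
          (solve 2 (λ q x → x :* q :^ 2 := q :* (q :* x)) ≈-refl qS (powS qS (suc (k + k))))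

ord-fineX : ∀ k → ord fineX k ≥ 1
ord-fineX zero    = ord-qS
ord-fineX (suc k) = ord-⊛ˡ q² (ord-fineX k)

pairRatio : ℕ → FPS
pairRatio k = ratio (fineX k) ⊛ ratio (qS ⊛ fineX k)

fine-unfolded : ∀ m →
  partialSum m (fineTerm qS) ≈[ m ] partialSum m (λ i → prodS i pairRatio ⊛ (oneS ⊕ ratio (fineX i)))
fine-unfolded m = ≈[]-trans (≈⇒≈[] m (≈-sym (⊛-identityˡ (partialSum m (fineTerm qS)))))
  (unfold-recurrence (λ k m → partialSum m (fineTerm (fineX k))) (λ k → fineError (fineX k))
     (λ k → oneS ⊕ ratio (fineX k)) pairRatio
     (λ k → fine-recurrence (ord-fineX k))
     (λ k → ord-⊛ˡ (ratio (qS ⊛ fineX k)) (ord-ratio (ord-fineX k)))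
     (λ k → ord-fineError (ord-fineX k))
     m 0)

lhsProduct : ℕ → FPS
lhsProduct n = prodS n (λ j → ratio (powS qS (suc j)))

ord-lhsProduct : ∀ n → ord lhsProduct n ≥ n
ord-lhsProduct n = ord-prodS n (λ j → ord-ratio (ord-⊛ˡ (powS qS j) ord-qS))

lhsTerm-suc : ∀ n → lhsTerm (suc n) ≈ lhsTerm n ⊛ ratio (powS qS (suc n))
lhsTerm-suc n = begin
  P ⊛ (oneS ⊖ x) ⊛ (const -1ℤ ⊛ σ) ⊛ powS qS (suc n + tri n) ⊛ invS (D ⊛ (oneS ⊖ negS qS ⊛ powS qS n))
    ≈⟨ ⊛-cong (*-congˡ {P ⊛ (oneS ⊖ x) ⊛ (const -1ℤ ⊛ σ)} (powS-+ qS (suc n) (tri n))) denominator ⟩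
  P ⊛ (oneS ⊖ x) ⊛ (const -1ℤ ⊛ σ) ⊛ (x ⊛ T) ⊛ (invS D ⊛ invS (oneS ⊕ x))
    ≈⟨ solve 6 (λ P σ T I x u → P :* (con 1ℤ :- x) :* (con -1ℤ :* σ) :* (x :* T) :* (I :* u)
                               := P :* σ :* T :* I :* ((con 1ℤ :- x) :* (:- x) :* u))
         ≈-refl P σ T (invS D) x (invS (oneS ⊕ x)) ⟩
  lhsTerm n ⊛ ratio x ∎
  where
  open ≈-Reasoning
  P σ T D x : FPS
  P = poch qS qS n
  σ = signS n
  T = powS qS (tri n)
  D = poch (negS qS) qS n
  x = powS qS (suc n)
  denominator : invS (D ⊛ (oneS ⊖ negS qS ⊛ powS qS n)) ≈ invS D ⊛ invS (oneS ⊕ x)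
  denominator = ≈-trans
    (invS-⊛ (poch-coeff₀ (negS qS) qS n refl)
            (1⊖-coeff₀ (negS qS ⊛ powS qS n) (⊛-coeff₀ (negS qS) (powS qS n) refl)))
    (*-congˡ {invS D} (invS-cong (1⊕-coeff₀ x (⊛-coeff₀ qS (powS qS n) refl))
       (solve 2 (λ q y → con 1ℤ :- (:- q) :* y := con 1ℤ :+ q :* y) ≈-refl qS (powS qS n))))

lhsTerm≈lhsProduct : ∀ n → lhsTerm n ≈ lhsProduct n
lhsTerm≈lhsProduct zero    = ≈-trans (*-congˡ {oneS ⊛ oneS ⊛ oneS} invS-oneS)
  (solve 0 (con 1ℤ :* con 1ℤ :* con 1ℤ :* con 1ℤ := con 1ℤ) ≈-refl)
lhsTerm≈lhsProduct (suc n) =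
  ≈-trans (lhsTerm-suc n) (*-congʳ {ratio (powS qS (suc n))} (lhsTerm≈lhsProduct n))

lhsProduct-pair : ∀ i →
  lhsProduct (i + i) ⊕ lhsProduct (suc (i + i)) ≈ prodS i pairRatio ⊛ (oneS ⊕ ratio (fineX i))
lhsProduct-pair i = begin
  lhsProduct (i + i) ⊕ lhsProduct (i + i) ⊛ ratio (powS qS (suc (i + i)))
    ≈⟨ solve 2 (λ L r → L :+ L :* r := L :* (con 1ℤ :+ r)) ≈-refl
         (lhsProduct (i + i)) (ratio (powS qS (suc (i + i)))) ⟩
  lhsProduct (i + i) ⊛ (oneS ⊕ ratio (powS qS (suc (i + i))))
    ≈⟨ ⊛-cong (≈-trans (prodS-pairs i _) (prodS-cong i (λ j → ⊛-cong (even j) (odd j))))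
              (+-congˡ {oneS} (even i)) ⟩
  prodS i pairRatio ⊛ (oneS ⊕ ratio (fineX i)) ∎
  where
  open ≈-Reasoning
  even : ∀ j → ratio (powS qS (suc (j + j))) ≈ ratio (fineX j)
  even j = ratio-cong (ord-fineX j) (≈-sym (fineX≈powS j))
  odd : ∀ j → ratio (powS qS (suc (suc (j + j)))) ≈ ratio (qS ⊛ fineX j)
  odd j = ratio-cong (ord-⊛ʳ qS (ord-fineX j)) (*-congˡ {qS} (≈-sym (fineX≈powS j)))

rhsTerm≈fineTerm : ∀ n → rhsTerm n ≈ fineTerm qS n
rhsTerm≈fineTerm n = ⊛-cong
  (≈-trans (⊛-assoc (poch qS q² n) (signS n) (powS qS n)) (*-congˡ {poch qS q² n} sign-power))
  (invS-cong (poch-coeff₀ (negS (qS ⊛ qS)) q² n refl)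
     (poch-cong q² n (solve 1 (λ q → :- (q :^ 2) := :- (q :* q)) ≈-refl qS)))
  where
  sign-power : signS n ⊛ powS qS n ≈ powS (negS qS) n
  sign-power = ≈-sym (≈-trans (powS-cong n (solve 1 (λ q → :- q := con -1ℤ :* q) ≈-refl qS))
                              (powS-⊛ (const -1ℤ) qS n))

proposition4p3 : (N : ℕ) → sumSeries lhsTerm N ≡ sumSeries rhsTerm N
proposition4p3 N = begin
  sumSeries lhsTerm N
    ≡⟨ sumSeries-cong N lhsTerm≈lhsProduct ⟩
  sumSeries lhsProduct N
    ≡⟨ sumSeries-truncate (suc N + suc N) ord-lhsProduct (ℕ.m≤m+n (suc N) (suc N)) ⟩
  partialSum (suc N + suc N) lhsProduct N
    ≡⟨ partialSum-pairs (suc N) lhsProduct N ⟩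
  partialSum (suc N) (λ i → lhsProduct (i + i) ⊕ lhsProduct (suc (i + i))) N
    ≡⟨ partialSum-cong (suc N) lhsProduct-pair N ⟩
  partialSum (suc N) (λ i → prodS i pairRatio ⊛ (oneS ⊕ ratio (fineX i))) N
    ≡⟨ sym (fine-unfolded (suc N) N ℕ.≤-refl) ⟩
  partialSum (suc N) (fineTerm qS) N
    ≡⟨ sym (sumSeries-truncate (suc N) (ord-fineTerm ord-qS) ℕ.≤-refl) ⟩
  sumSeries (fineTerm qS) N
    ≡⟨ sym (sumSeries-cong N rhsTerm≈fineTerm) ⟩
  sumSeries rhsTerm N ∎
  where open ≡-Reasoning
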